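{- For every $m$-by-$n$ $(0,1,\ast)$-matrix $A$, $\mathrm{lin}(A)=2^{n-\mathrm{mr}(A)}$.
   Context: A $(0,1,\ast)$-matrix has entries in $\{0,1,\ast\}$; arithmetic is over $GF_2$. A completion of $A$ is obtained by replacing each $\ast$ by $0$ or $1$; $\mathrm{mr}(A)$ is the minimum $GF_2$-rank of a completion. For $A=(a_{ij})$, an operator $G=(g_1,\dots,g_m):\{0,1\}^n\to\{0,1\}^m$ is consistent with $A$ if each $g_i$ depends only on variables $x_j$ with $a_{ij}=\ast$. A set $L\subseteq\{0,1\}^n$ is a solution for $A$ if there exist a completion $M$ and a consistent $G$ with $M\mathbf{x}=G(\mathbf{x})$ for all $\mathbf{x}\in L$; it is a linear solution if moreover $L$ is a linear subspace of $GF_2^n$. $\mathrm{lin}(A)$ is the maximum size of a linear solution for $A$. -}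

module Defs where

open import Data.Bool using (Bool; true; false; _xor_; _∧_)
open import Data.Nat using (ℕ; zero; suc; _≤_)
open import Data.Fin using (Fin; zero; suc)
open import Data.Vec using (Vec; []; _∷_; lookup; zipWith; replicate)
open import Data.List using (List; []; _∷_; _++_; map; length; filterᵇ)
open import Data.Product using (Σ; ∃; _×_; _,_)
open import Relation.Binary.PropositionalEquality using (_≡_)

-- GF(2) is modelled by Bool: addition = xor, multiplication = ∧.

data Entry : Set where
  0ₑ 1ₑ ∗ : Entry

PMatrix : ℕ → ℕ → Set
PMatrix m n = Fin m → Fin n → Entry

BMatrix : ℕ → ℕ → Set
BMatrix m n = Fin m → Fin n → Bool

⊕ : ∀ {k} → (Fin k → Bool) → Bool
⊕ {zero} f = false
⊕ {suc k} f = f zero xor ⊕ (λ i → f (suc i))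

_·_ : ∀ {m n} → BMatrix m n → Vec Bool n → Fin m → Bool
(M · x) i = ⊕ (λ j → M i j ∧ lookup x j)

IndependentCols : ∀ {m n k} → BMatrix m n → (Fin k → Fin n) → Set
IndependentCols {k = k} M f =
  (c : Fin k → Bool) →
  (∀ i → ⊕ (λ t → c t ∧ M i (f t)) ≡ false) →
  ∀ t → c t ≡ false

IsRank : ∀ {m n} → BMatrix m n → ℕ → Set
IsRank {m} {n} M r =
  (Σ (Fin r → Fin n) λ f → IndependentCols M f) ×
  (∀ k → (f : Fin k → Fin n) → IndependentCols M f → k ≤ r)

Agrees : Entry → Bool → Set
Agrees 0ₑ b = b ≡ false
Agrees 1ₑ b = b ≡ true
Agrees ∗  b = Data.Unit.⊤
  where import Data.Unit

IsCompletion : ∀ {m n} → PMatrix m n → BMatrix m n → Set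
IsCompletion A M = ∀ i j → Agrees (A i j) (M i j)

IsMinRank : ∀ {m n} → PMatrix m n → ℕ → Set
IsMinRank A r =
  (Σ _ λ M → IsCompletion A M × IsRank M r) ×
  (∀ M s → IsCompletion A M → IsRank M s → r ≤ s)

Operator : ℕ → ℕ → Set
Operator m n = Vec Bool n → Vec Bool m

IsStar : Entry → Set
IsStar ∗ = Data.Unit.⊤
  where import Data.Unit
IsStar 0ₑ = Data.Empty.⊥
  where import Data.Empty
IsStar 1ₑ = Data.Empty.⊥
  where import Data.Empty

Consistent : ∀ {m n} → PMatrix m n → Operator m n → Set
Consistent A G =
  ∀ i x y → (∀ j → IsStar (A i j) → lookup x j ≡ lookup y j) →
  lookup (G x) i ≡ lookup (G y) i

VSet : ℕ → Set
VSet n = Vec Bool n → Bool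

_∈ᵥ_ : ∀ {n} → Vec Bool n → VSet n → Set
x ∈ᵥ L = L x ≡ true

IsSolution : ∀ {m n} → PMatrix m n → VSet n → Set
IsSolution {m} {n} A L =
  Σ (BMatrix m n) λ M → Σ (Operator m n) λ G →
    IsCompletion A M × Consistent A G ×
    (∀ x → x ∈ᵥ L → ∀ i → (M · x) i ≡ lookup (G x) i)

IsSubspace : ∀ {n} → VSet n → Set
IsSubspace {n} L =
  (replicate n false ∈ᵥ L) ×
  (∀ x y → x ∈ᵥ L → y ∈ᵥ L → zipWith _xor_ x y ∈ᵥ L)

IsLinearSolution : ∀ {m n} → PMatrix m n → VSet n → Set
IsLinearSolution A L = IsSolution A L × IsSubspace L

allVecs : (n : ℕ) → List (Vec Bool n)
allVecs zero = [] ∷ []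
allVecs (suc n) = map (false ∷_) (allVecs n) ++ map (true ∷_) (allVecs n)

∣_∣ᵥ : ∀ {n} → VSet n → ℕ
∣_∣ᵥ {n} L = length (filterᵇ L (allVecs n))

IsLin : ∀ {m n} → PMatrix m n → ℕ → Set
IsLin A s =
  (Σ _ λ L → IsLinearSolution A L × ∣ L ∣ᵥ ≡ s) ×
  (∀ L → IsLinearSolution A L → ∣ L ∣ᵥ ≤ s)

-- The minimum rank r is attained by some completion M, and ker M is a linear solution
-- (with the zero operator) of size 2^(n - r) by rank-nullity.  Conversely, let M x = G x
-- on a subspace L with G consistent with A.  Row i of M then vanishes on the vectors of L
-- that are zero on the ∗-positions of row i (since G x agrees there with G 0 = M 0 = 0),
-- and peeling off one coordinate at a time shows that, on L, it coincides with a
-- functional supported on those ∗-positions.  Subtracting these functionals from the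
-- rows of M yields another completion M′ with L ⊆ ker M′, whence
-- |L| ≤ 2^(n - rank M′) ≤ 2^(n - r).

module Submission where

open import Defs
open import Data.Nat using (ℕ; _^_; _∸_)
open import Data.Product using (Σ; _×_)

open import Algebra.Bundles using (CommutativeRing; CommutativeMonoid)
open import Data.Bool as Bool using (Bool; true; false; _xor_; _∧_; not; if_then_else_)
open import Data.Bool.Properties
  using (xor-∧-commutativeRing; ∧-commutativeMonoid; xor-same; xor-identityʳ; xor-comm; xor-assoc;
         ∧-comm; ∧-assoc; ∧-zeroʳ; ∧-identityʳ; ∧-distribˡ-xor; ∧-distribʳ-xor;
         ∧-conicalˡ; ∧-conicalʳ; not-involutive; ¬-not)
open import Data.Empty using (⊥-elim)
open import Data.Fin using (Fin; zero; suc; punchIn)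
open import Data.Fin.Properties using (_≟_; any?)
open import Data.List as List using (List; map; length; filterᵇ; allFin)
open import Data.List.Membership.Propositional using (_∈_)
open import Data.List.Membership.Propositional.Properties using (∈-filter⁺; ∈-filter⁻; ∈-allFin)
open import Data.List.Properties using (length-++; filter-++)
open import Data.List.Relation.Unary.Any using (here; there)
open import Data.Nat using (zero; suc; _+_; _≤_; z≤n; s≤s)
open import Data.Nat.Properties
  using (≤-refl; ≤-reflexive; ≤-trans; ≤-antisym; <⇒≤; ≰⇒>; _≤?_; m≤n⇒m≤1+n;
         +-comm; +-identityʳ; +-mono-≤; +-∸-assoc; ^-monoʳ-≤; ∸-monoʳ-≤; module ≤-Reasoning)
open import Data.Product using (_,_; proj₁; proj₂)
open import Data.Sum using (_⊎_; inj₁; inj₂)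
open import Data.Unit using (tt)
open import Data.Vec using (Vec; []; _∷_; lookup; zipWith; replicate; tabulate)
open import Data.Vec.Properties using (lookup-zipWith; lookup-replicate; lookup∘tabulate)
open import Data.Vec.Functional using (Vector; insertAt)
open import Data.Vec.Functional.Properties using (insertAt-lookup; insertAt-punchIn)
open import Relation.Binary.PropositionalEquality
  using (_≡_; _≗_; refl; sym; trans; cong; cong₂; subst; subst₂; module ≡-Reasoning)
open import Relation.Nullary using (does; yes; no; contradiction)
open import Relation.Unary using (Decidable)

open CommutativeRing xor-∧-commutativeRing using (semiring)
open CommutativeMonoid ∧-commutativeMonoid using (commutativeSemigroup)
open import Algebra.Properties.CommutativeSemigroup commutativeSemigroup using (x∙yz≈y∙zx)
open import Algebra.Properties.Semiring.Sum semiring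
  using (sum; sum-cong-≗; sum-replicate-zero; sum-remove; ∑-distrib-+; ∑-comm;
         *-distribˡ-sum; *-distribʳ-sum)

xor≡false⇒≡ : ∀ {a b} → a xor b ≡ false → a ≡ b
xor≡false⇒≡ {false} {false} _ = refl
xor≡false⇒≡ {true}  {true}  _ = refl

≡⇒xor≡false : ∀ {a b} → a ≡ b → a xor b ≡ false
≡⇒xor≡false {a} refl = xor-same a

xor-cancel : ∀ {a a₀ c c₀} → a xor a₀ ≡ c xor c₀ → a ≡ c xor (a₀ xor c₀)
xor-cancel {a} {a₀} {c} {c₀} eq = begin
  a                        ≡⟨ sym (trans (cong (a xor_) (xor-same a₀)) (xor-identityʳ a)) ⟩
  a xor (a₀ xor a₀)        ≡⟨ sym (xor-assoc a a₀ a₀) ⟩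
  (a xor a₀) xor a₀        ≡⟨ cong (_xor a₀) eq ⟩
  (c xor c₀) xor a₀        ≡⟨ xor-assoc c c₀ a₀ ⟩
  c xor (c₀ xor a₀)        ≡⟨ cong (c xor_) (xor-comm c₀ a₀) ⟩
  c xor (a₀ xor c₀)        ∎
  where open ≡-Reasoning

⊕≡sum : ∀ {k} (f : Fin k → Bool) → ⊕ f ≡ sum f
⊕≡sum {zero}  f = refl
⊕≡sum {suc k} f = cong (f zero xor_) (⊕≡sum (λ i → f (suc i)))

⊕-cong : ∀ {k} {f g : Fin k → Bool} → f ≗ g → ⊕ f ≡ ⊕ g
⊕-cong {f = f} {g} f≗g = trans (⊕≡sum f) (trans (sum-cong-≗ {x = f} {y = g} f≗g) (sym (⊕≡sum g)))

⊕-zero : ∀ {k} {f : Fin k → Bool} → (∀ i → f i ≡ false) → ⊕ f ≡ false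
⊕-zero {k} f≗0 = trans (⊕-cong f≗0) (trans (⊕≡sum {k} _) (sum-replicate-zero k))

⊕-distrib-xor : ∀ {k} (f g : Fin k → Bool) → ⊕ (λ i → f i xor g i) ≡ ⊕ f xor ⊕ g
⊕-distrib-xor {k} f g = begin
  ⊕ (λ i → f i xor g i)  ≡⟨ ⊕≡sum {k} _ ⟩
  sum (λ i → f i xor g i) ≡⟨ ∑-distrib-+ f g ⟩
  sum f xor sum g         ≡⟨ sym (cong₂ _xor_ (⊕≡sum f) (⊕≡sum g)) ⟩
  ⊕ f xor ⊕ g             ∎
  where open ≡-Reasoning

∧-distribˡ-⊕ : ∀ {k} b (f : Fin k → Bool) → b ∧ ⊕ f ≡ ⊕ (λ i → b ∧ f i)
∧-distribˡ-⊕ {k} b f =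
  trans (cong (b ∧_) (⊕≡sum f)) (trans (*-distribˡ-sum b f) (sym (⊕≡sum {k} _)))

∧-distribʳ-⊕ : ∀ {k} b (f : Fin k → Bool) → ⊕ f ∧ b ≡ ⊕ (λ i → f i ∧ b)
∧-distribʳ-⊕ {k} b f =
  trans (cong (_∧ b) (⊕≡sum f)) (trans (*-distribʳ-sum b f) (sym (⊕≡sum {k} _)))

⊕-comm : ∀ {k l} (f : Fin k → Fin l → Bool) →
         ⊕ (λ i → ⊕ (f i)) ≡ ⊕ (λ j → ⊕ (λ i → f i j))
⊕-comm {k} {l} f = begin
  ⊕ (λ i → ⊕ (f i))               ≡⟨ ⊕≡sum {k} _ ⟩
  sum (λ i → ⊕ (f i))             ≡⟨ sum-cong-≗ {x = λ i → ⊕ (f i)} (λ i → ⊕≡sum (f i)) ⟩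
  sum (λ i → sum (f i))           ≡⟨ ∑-comm f ⟩
  sum (λ j → sum (λ i → f i j))   ≡⟨ sum-cong-≗ {y = λ j → ⊕ (λ i → f i j)}
                                                (λ j → sym (⊕≡sum {k} _)) ⟩
  sum (λ j → ⊕ (λ i → f i j))     ≡⟨ sym (⊕≡sum {l} _) ⟩
  ⊕ (λ j → ⊕ (λ i → f i j))       ∎
  where open ≡-Reasoning

⊕-punchIn : ∀ {k} (p : Fin (suc k)) (f : Fin (suc k) → Bool) →
            ⊕ f ≡ f p xor ⊕ (λ t → f (punchIn p t))
⊕-punchIn {k} p f = begin
  ⊕ f                                 ≡⟨ ⊕≡sum f ⟩
  sum f                               ≡⟨ sum-remove {i = p} f ⟩
  f p xor sum (λ t → f (punchIn p t)) ≡⟨ sym (cong (f p xor_) (⊕≡sum {k} _)) ⟩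
  f p xor ⊕ (λ t → f (punchIn p t))   ∎
  where open ≡-Reasoning

δ : ∀ {n} → Fin n → Fin n → Bool
δ a b = does (a ≟ b)

δ≡true⇒≡ : ∀ {n} {a b : Fin n} → δ a b ≡ true → a ≡ b
δ≡true⇒≡ {a = a} {b} δab with a ≟ b
... | yes a≡b = a≡b

⊕-δ : ∀ {n} (a : Fin n) (h : Fin n → Bool) → ⊕ (λ j → δ a j ∧ h j) ≡ h a
⊕-δ {suc n} zero    h = trans (cong (h zero xor_) (⊕-zero {n} λ _ → refl)) (xor-identityʳ (h zero))
⊕-δ {suc n} (suc a) h = ⊕-δ a (λ j → h (suc j))

dot : ∀ {n} → (Fin n → Bool) → Vec Bool n → Bool
dot a x = ⊕ (λ j → a j ∧ lookup x j)

dot-xorʳ : ∀ {n} (a : Fin n → Bool) (x y : Vec Bool n) →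
           dot a (zipWith _xor_ x y) ≡ dot a x xor dot a y
dot-xorʳ {n} a x y = trans
  (⊕-cong λ j → trans (cong (a j ∧_) (lookup-zipWith _xor_ j x y)) (∧-distribˡ-xor (a j) _ _))
  (⊕-distrib-xor {n} _ _)

dot-xorˡ : ∀ {n} (a b : Fin n → Bool) (x : Vec Bool n) →
           dot (λ j → a j xor b j) x ≡ dot a x xor dot b x
dot-xorˡ {n} a b x = trans (⊕-cong λ j → ∧-distribʳ-xor _ (a j) (b j)) (⊕-distrib-xor {n} _ _)

dot-zeroʳ : ∀ {n} (a : Fin n → Bool) → dot a (replicate n false) ≡ false
dot-zeroʳ a = ⊕-zero λ j → trans (cong (a j ∧_) (lookup-replicate j false)) (∧-zeroʳ (a j))

allFalse : ∀ {m} → (Fin m → Bool) → Bool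
allFalse {zero}  f = true
allFalse {suc m} f = not (f zero) ∧ allFalse (λ i → f (suc i))

allFalse-intro : ∀ {m} {f : Fin m → Bool} → (∀ i → f i ≡ false) → allFalse f ≡ true
allFalse-intro {zero}  f≗0 = refl
allFalse-intro {suc m} f≗0 rewrite f≗0 zero = allFalse-intro (λ i → f≗0 (suc i))

allFalse-elim : ∀ {m} (f : Fin m → Bool) → allFalse f ≡ true → ∀ i → f i ≡ false
allFalse-elim {suc m} f all0 i with f zero in f0≡
allFalse-elim {suc m} f all0 zero    | false = f0≡
allFalse-elim {suc m} f all0 (suc i) | false = allFalse-elim (λ i → f (suc i)) all0 i

allFalse-cong : ∀ {m} {f g : Fin m → Bool} → f ≗ g → allFalse f ≡ allFalse g
allFalse-cong {zero}  f≗g = refl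
allFalse-cong {suc m} f≗g =
  cong₂ (λ a b → not a ∧ b) (f≗g zero) (allFalse-cong (λ i → f≗g (suc i)))

ker : ∀ {m n} → BMatrix m n → VSet n
ker M x = allFalse (M · x)

ker-isSubspace : ∀ {m n} (M : BMatrix m n) → IsSubspace (ker M)
ker-isSubspace M =
  allFalse-intro (λ i → dot-zeroʳ (M i)) ,
  λ x y x∈ y∈ → allFalse-intro λ i → trans (dot-xorʳ (M i) x y)
    (cong₂ _xor_ (allFalse-elim _ x∈ i) (allFalse-elim _ y∈ i))

length-filterᵇ-map : ∀ {A B : Set} (P : B → Bool) (g : A → B) (xs : List A) →
  length (filterᵇ P (map g xs)) ≡ length (filterᵇ (λ a → P (g a)) xs)
length-filterᵇ-map P g List.[] = refl
length-filterᵇ-map P g (x List.∷ xs) with P (g x)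
... | true  = cong suc (length-filterᵇ-map P g xs)
... | false = length-filterᵇ-map P g xs

∣∣ᵥ-suc : ∀ {n} (P : VSet (suc n)) →
          ∣ P ∣ᵥ ≡ ∣ (λ x → P (false ∷ x)) ∣ᵥ + ∣ (λ x → P (true ∷ x)) ∣ᵥ
∣∣ᵥ-suc {n} P = begin
  length (filterᵇ P (map (false ∷_) (allVecs n) List.++ map (true ∷_) (allVecs n)))
    ≡⟨ cong length (filter-++ _ (map (false ∷_) (allVecs n)) _) ⟩
  length (filterᵇ P (map (false ∷_) (allVecs n)) List.++ filterᵇ P (map (true ∷_) (allVecs n)))
    ≡⟨ length-++ (filterᵇ P (map (false ∷_) (allVecs n))) ⟩
  length (filterᵇ P (map (false ∷_) (allVecs n))) + length (filterᵇ P (map (true ∷_) (allVecs n)))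
    ≡⟨ cong₂ _+_ (length-filterᵇ-map P _ (allVecs n)) (length-filterᵇ-map P _ (allVecs n)) ⟩
  ∣ (λ x → P (false ∷ x)) ∣ᵥ + ∣ (λ x → P (true ∷ x)) ∣ᵥ ∎
  where open ≡-Reasoning

∣∣ᵥ-zero : (P : VSet 0) → ∣ P ∣ᵥ ≡ (if P [] then 1 else 0)
∣∣ᵥ-zero P with P []
... | true  = refl
... | false = refl

∣∣ᵥ-cong : ∀ {n} {P Q : VSet n} → (∀ x → P x ≡ Q x) → ∣ P ∣ᵥ ≡ ∣ Q ∣ᵥ
∣∣ᵥ-cong {zero} {P} {Q} P≗Q =
  trans (∣∣ᵥ-zero P) (trans (cong (if_then 1 else 0) (P≗Q [])) (sym (∣∣ᵥ-zero Q)))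
∣∣ᵥ-cong {suc n} {P} {Q} P≗Q = begin
  ∣ P ∣ᵥ
    ≡⟨ ∣∣ᵥ-suc P ⟩
  ∣ (λ x → P (false ∷ x)) ∣ᵥ + ∣ (λ x → P (true ∷ x)) ∣ᵥ
    ≡⟨ cong₂ _+_ (∣∣ᵥ-cong (λ x → P≗Q (false ∷ x))) (∣∣ᵥ-cong (λ x → P≗Q (true ∷ x))) ⟩
  ∣ (λ x → Q (false ∷ x)) ∣ᵥ + ∣ (λ x → Q (true ∷ x)) ∣ᵥ
    ≡⟨ sym (∣∣ᵥ-suc Q) ⟩
  ∣ Q ∣ᵥ ∎
  where open ≡-Reasoning

∣∣ᵥ-mono : ∀ {n} {P Q : VSet n} → (∀ x → x ∈ᵥ P → x ∈ᵥ Q) → ∣ P ∣ᵥ ≤ ∣ Q ∣ᵥ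
∣∣ᵥ-mono {zero} {P} {Q} P⊆Q rewrite ∣∣ᵥ-zero P | ∣∣ᵥ-zero Q with P [] | Q [] | P⊆Q []
... | false | _     | _   = z≤n
... | true  | true  | _   = ≤-refl
... | true  | false | P⊆Q[] with () ← P⊆Q[] refl
∣∣ᵥ-mono {suc n} {P} {Q} P⊆Q = subst₂ _≤_ (sym (∣∣ᵥ-suc P)) (sym (∣∣ᵥ-suc Q))
  (+-mono-≤ (∣∣ᵥ-mono (λ x → P⊆Q (false ∷ x))) (∣∣ᵥ-mono (λ x → P⊆Q (true ∷ x))))

∣∣ᵥ-empty : ∀ {n} {P : VSet n} → (∀ x → P x ≡ false) → ∣ P ∣ᵥ ≡ 0
∣∣ᵥ-empty {zero} {P} P≗0 rewrite ∣∣ᵥ-zero P | P≗0 [] = refl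
∣∣ᵥ-empty {suc n} {P} P≗0 = trans (∣∣ᵥ-suc P)
  (cong₂ _+_ (∣∣ᵥ-empty (λ x → P≗0 (false ∷ x))) (∣∣ᵥ-empty (λ x → P≗0 (true ∷ x))))

∣∣ᵥ-translate : ∀ {n} (y : Vec Bool n) (P : VSet n) →
                ∣ (λ x → P (zipWith _xor_ y x)) ∣ᵥ ≡ ∣ P ∣ᵥ
∣∣ᵥ-translate []          P = ∣∣ᵥ-cong {P = λ x → P (zipWith _xor_ [] x)} {P} λ { [] → refl }
∣∣ᵥ-translate (false ∷ y) P = begin
  ∣ (λ x → P (zipWith _xor_ (false ∷ y) x)) ∣ᵥ
    ≡⟨ ∣∣ᵥ-suc (λ x → P (zipWith _xor_ (false ∷ y) x)) ⟩
  ∣ (λ x → P (false ∷ zipWith _xor_ y x)) ∣ᵥ + ∣ (λ x → P (true ∷ zipWith _xor_ y x)) ∣ᵥ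
    ≡⟨ cong₂ _+_ (∣∣ᵥ-translate y _) (∣∣ᵥ-translate y _) ⟩
  ∣ (λ x → P (false ∷ x)) ∣ᵥ + ∣ (λ x → P (true ∷ x)) ∣ᵥ
    ≡⟨ sym (∣∣ᵥ-suc P) ⟩
  ∣ P ∣ᵥ ∎
  where open ≡-Reasoning
∣∣ᵥ-translate (true ∷ y) P = begin
  ∣ (λ x → P (zipWith _xor_ (true ∷ y) x)) ∣ᵥ
    ≡⟨ ∣∣ᵥ-suc (λ x → P (zipWith _xor_ (true ∷ y) x)) ⟩
  ∣ (λ x → P (true ∷ zipWith _xor_ y x)) ∣ᵥ + ∣ (λ x → P (false ∷ zipWith _xor_ y x)) ∣ᵥ
    ≡⟨ cong₂ _+_ (∣∣ᵥ-translate y _) (∣∣ᵥ-translate y _) ⟩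
  ∣ (λ x → P (true ∷ x)) ∣ᵥ + ∣ (λ x → P (false ∷ x)) ∣ᵥ
    ≡⟨ +-comm (∣ (λ x → P (true ∷ x)) ∣ᵥ) _ ⟩
  ∣ (λ x → P (false ∷ x)) ∣ᵥ + ∣ (λ x → P (true ∷ x)) ∣ᵥ
    ≡⟨ sym (∣∣ᵥ-suc P) ⟩
  ∣ P ∣ᵥ ∎
  where open ≡-Reasoning

find : ∀ {n} (P : VSet n) → (Σ (Vec Bool n) λ x → x ∈ᵥ P) ⊎ (∀ x → P x ≡ false)
find {zero} P with P [] in P[]
... | true  = inj₁ ([] , P[])
... | false = inj₂ λ { [] → P[] }
find {suc n} P with find (λ x → P (false ∷ x)) | find (λ x → P (true ∷ x))
... | inj₁ (x , x∈) | _             = inj₁ (false ∷ x , x∈)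
... | inj₂ _        | inj₁ (x , x∈) = inj₁ (true ∷ x , x∈)
... | inj₂ none₀    | inj₂ none₁    = inj₂ λ { (false ∷ x) → none₀ x ; (true ∷ x) → none₁ x }

-- Spans and the Steinitz exchange lemma

lincomb : ∀ {k m} → (Fin k → Bool) → (Fin k → Vector Bool m) → Vector Bool m
lincomb c u i = ⊕ (λ t → c t ∧ u t i)

Independent : ∀ {k m} → (Fin k → Vector Bool m) → Set
Independent u = ∀ c → (∀ i → lincomb c u i ≡ false) → ∀ t → c t ≡ false

InSpan : ∀ {r m} → (Fin r → Vector Bool m) → Vector Bool m → Set
InSpan {r} w v = Σ (Fin r → Bool) λ d → v ≗ lincomb d w

lincomb-xorˡ : ∀ {k m} (c d : Fin k → Bool) (w : Fin k → Vector Bool m) i →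
               lincomb (λ t → c t xor d t) w i ≡ lincomb c w i xor lincomb d w i
lincomb-xorˡ {k} c d w i =
  trans (⊕-cong λ t → ∧-distribʳ-xor (w t i) (c t) (d t)) (⊕-distrib-xor {k} _ _)

lincomb-xorʳ : ∀ {k m} (c : Fin k → Bool) (u v : Fin k → Vector Bool m) i →
               lincomb c (λ t j → u t j xor v t j) i ≡ lincomb c u i xor lincomb c v i
lincomb-xorʳ {k} c u v i =
  trans (⊕-cong λ t → ∧-distribˡ-xor (c t) (u t i) (v t i)) (⊕-distrib-xor {k} _ _)

lincomb-∧ˡ : ∀ {k m} a (c : Fin k → Bool) (w : Fin k → Vector Bool m) i →
             lincomb (λ t → a ∧ c t) w i ≡ a ∧ lincomb c w i
lincomb-∧ˡ a c w i =
  trans (⊕-cong λ t → ∧-assoc a (c t) (w t i)) (sym (∧-distribˡ-⊕ a λ t → c t ∧ w t i))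

lincomb-rankOne : ∀ {k m} (c b : Fin k → Bool) (v : Vector Bool m) i →
                  lincomb c (λ t j → b t ∧ v j) i ≡ ⊕ (λ t → c t ∧ b t) ∧ v i
lincomb-rankOne c b v i =
  trans (⊕-cong λ t → sym (∧-assoc (c t) (b t) (v i))) (sym (∧-distribʳ-⊕ (v i) λ t → c t ∧ b t))

lincomb-tail : ∀ {k m} (c : Fin (suc k) → Bool) (w : Fin (suc k) → Vector Bool m) →
               c zero ≡ false → lincomb c w ≗ lincomb (λ t → c (suc t)) (λ t → w (suc t))
lincomb-tail c w c₀≡false i rewrite c₀≡false = refl

InSpan-tail : ∀ {r m} {w : Fin (suc r) → Vector Bool m} {v} →
              ((d , _) : InSpan w v) → d zero ≡ false → InSpan (λ s → w (suc s)) v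
InSpan-tail {w = w} (d , v≗dw) d₀≡false =
  (λ s → d (suc s)) , λ i → trans (v≗dw i) (lincomb-tail d w d₀≡false i)

InSpan-lincomb : ∀ {r k m} (w : Fin r → Vector Bool m) (g : Fin k → Vector Bool m) →
                 (∀ t → InSpan w (g t)) → ∀ c → InSpan w (lincomb c g)
InSpan-lincomb {r} {k} w g g∈ c = (λ s → ⊕ (λ t → c t ∧ proj₁ (g∈ t) s)) , λ i → begin
  ⊕ (λ t → c t ∧ g t i)
    ≡⟨ ⊕-cong (λ t → cong (c t ∧_) (proj₂ (g∈ t) i)) ⟩
  ⊕ (λ t → c t ∧ ⊕ (λ s → d t s ∧ w s i))
    ≡⟨ ⊕-cong (λ t → ∧-distribˡ-⊕ (c t) λ s → d t s ∧ w s i) ⟩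
  ⊕ (λ t → ⊕ (λ s → c t ∧ (d t s ∧ w s i)))
    ≡⟨ ⊕-comm (λ t s → c t ∧ (d t s ∧ w s i)) ⟩
  ⊕ (λ s → ⊕ (λ t → c t ∧ (d t s ∧ w s i)))
    ≡⟨ ⊕-cong (λ s → lincomb-rankOne c (λ t → d t s) (w s) i) ⟩
  ⊕ (λ s → ⊕ (λ t → c t ∧ d t s) ∧ w s i) ∎
  where
  open ≡-Reasoning
  d : Fin k → Fin r → Bool
  d t = proj₁ (g∈ t)

exchange : ∀ {k r m} {u : Fin (suc k) → Vector Bool m} {w : Fin (suc r) → Vector Bool m} →
           Independent u → (u∈ : ∀ t → InSpan w (u t)) →
           (t₀ : Fin (suc k)) → proj₁ (u∈ t₀) zero ≡ true →
           Σ (Fin k → Vector Bool m) λ u′ → Independent u′ × (∀ t → InSpan (λ s → w (suc s)) (u′ t))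
exchange {k} {r} {m} {u} {w} ind u∈ t₀ a₀≡true = u′ , independent′ , inSpan′
  where
  d : Fin (suc k) → Fin (suc r) → Bool
  d t = proj₁ (u∈ t)
  a : Fin k → Bool
  a t = d (punchIn t₀ t) zero
  -- u t₀ has w zero-coefficient 1 and is used to clear that coefficient from the others.
  u′ : Fin k → Vector Bool m
  u′ t i = u (punchIn t₀ t) i xor (a t ∧ u t₀ i)

  inSpan′ : ∀ t → InSpan (λ s → w (suc s)) (u′ t)
  inSpan′ t = InSpan-tail {w = w} (e , u′≗ew) e₀≡false
    where
    e : Fin (suc r) → Bool
    e s = d (punchIn t₀ t) s xor (a t ∧ d t₀ s)
    e₀≡false : e zero ≡ false
    e₀≡false = trans (cong (λ b → a t xor (a t ∧ b)) a₀≡true)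
                     (trans (cong (a t xor_) (∧-identityʳ (a t))) (xor-same (a t)))
    u′≗ew : u′ t ≗ lincomb e w
    u′≗ew i = begin
      u (punchIn t₀ t) i xor (a t ∧ u t₀ i)
        ≡⟨ cong₂ (λ x y → x xor (a t ∧ y)) (proj₂ (u∈ (punchIn t₀ t)) i) (proj₂ (u∈ t₀) i) ⟩
      lincomb (d (punchIn t₀ t)) w i xor (a t ∧ lincomb (d t₀) w i)
        ≡⟨ cong (lincomb (d (punchIn t₀ t)) w i xor_) (sym (lincomb-∧ˡ (a t) (d t₀) w i)) ⟩
      lincomb (d (punchIn t₀ t)) w i xor lincomb (λ s → a t ∧ d t₀ s) w i
        ≡⟨ sym (lincomb-xorˡ (d (punchIn t₀ t)) (λ s → a t ∧ d t₀ s) w i) ⟩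
      lincomb e w i ∎
      where open ≡-Reasoning

  independent′ : Independent u′
  independent′ c′ c′u′≡0 t = begin
    c′ t                ≡⟨ sym (insertAt-punchIn c′ t₀ β t) ⟩
    c (punchIn t₀ t)    ≡⟨ ind c cu≡0 (punchIn t₀ t) ⟩
    false               ∎
    where
    open ≡-Reasoning
    β : Bool
    β = ⊕ (λ t → c′ t ∧ a t)
    c : Fin (suc k) → Bool
    c = insertAt c′ t₀ β
    cu≡0 : ∀ i → lincomb c u i ≡ false
    cu≡0 i = begin
      lincomb c u i
        ≡⟨ ⊕-punchIn t₀ (λ t → c t ∧ u t i) ⟩
      (c t₀ ∧ u t₀ i) xor ⊕ (λ t → c (punchIn t₀ t) ∧ u (punchIn t₀ t) i)
        ≡⟨ cong₂ _xor_ (cong (_∧ u t₀ i) (insertAt-lookup c′ t₀ β))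
                       (⊕-cong λ t → cong (_∧ u (punchIn t₀ t) i) (insertAt-punchIn c′ t₀ β t)) ⟩
      (β ∧ u t₀ i) xor lincomb c′ (λ t → u (punchIn t₀ t)) i
        ≡⟨ xor-comm (β ∧ u t₀ i) _ ⟩
      lincomb c′ (λ t → u (punchIn t₀ t)) i xor (β ∧ u t₀ i)
        ≡⟨ cong (lincomb c′ (λ t → u (punchIn t₀ t)) i xor_) (sym (lincomb-rankOne c′ a (u t₀) i)) ⟩
      lincomb c′ (λ t → u (punchIn t₀ t)) i xor lincomb c′ (λ t j → a t ∧ u t₀ j) i
        ≡⟨ sym (lincomb-xorʳ c′ (λ t → u (punchIn t₀ t)) (λ t j → a t ∧ u t₀ j) i) ⟩
      lincomb c′ u′ i
        ≡⟨ c′u′≡0 i ⟩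
      false ∎

steinitz : ∀ {k r m} (u : Fin k → Vector Bool m) (w : Fin r → Vector Bool m) →
           Independent u → (∀ t → InSpan w (u t)) → k ≤ r
steinitz {zero}          u w ind u∈ = z≤n
steinitz {suc k} {zero}  u w ind u∈ = contradiction (ind (δ zero) u₀≡0 zero) λ ()
  where
  u₀≡0 : ∀ i → lincomb (δ zero) u i ≡ false
  u₀≡0 i = cong₂ _xor_ (proj₂ (u∈ zero) i) (⊕-zero {k} λ _ → refl)
steinitz {suc k} {suc r} u w ind u∈ with any? (λ t → proj₁ (u∈ t) zero Bool.≟ true)
... | yes (t₀ , a₀≡true) =
  let (u′ , independent′ , inSpan′) = exchange {w = w} ind u∈ t₀ a₀≡true
  in s≤s (steinitz u′ (λ s → w (suc s)) independent′ inSpan′)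
... | no ∄t₀ = m≤n⇒m≤1+n (steinitz u (λ s → w (suc s)) ind
                   λ t → InSpan-tail {w = w} (u∈ t) (¬-not λ a≡true → ∄t₀ (t , a≡true)))

-- Rank and nullity

column : ∀ {m n} → BMatrix m n → Fin n → Vector Bool m
column M j i = M i j

·-as-lincomb : ∀ {m n} (M : BMatrix m n) (x : Vec Bool n) → M · x ≗ lincomb (lookup x) (column M)
·-as-lincomb M x i = ⊕-cong λ j → ∧-comm (M i j) (lookup x j)

lincomb-columns : ∀ {m n r} (M : BMatrix m n) (f : Fin r → Fin n) (c : Fin r → Bool) →
                  Σ (Vec Bool n) λ x → M · x ≗ lincomb c (λ t → column M (f t))
lincomb-columns {m} {n} {r} M f c = tabulate x , λ i → begin
  ⊕ (λ j → M i j ∧ lookup (tabulate x) j)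
    ≡⟨ ⊕-cong (λ j → cong (M i j ∧_) (lookup∘tabulate x j)) ⟩
  ⊕ (λ j → M i j ∧ ⊕ (λ t → c t ∧ δ (f t) j))
    ≡⟨ ⊕-cong (λ j → ∧-distribˡ-⊕ (M i j) λ t → c t ∧ δ (f t) j) ⟩
  ⊕ (λ j → ⊕ (λ t → M i j ∧ (c t ∧ δ (f t) j)))
    ≡⟨ ⊕-comm (λ j t → M i j ∧ (c t ∧ δ (f t) j)) ⟩
  ⊕ (λ t → ⊕ (λ j → M i j ∧ (c t ∧ δ (f t) j)))
    ≡⟨ ⊕-cong (λ t → ⊕-cong λ j → x∙yz≈y∙zx (M i j) (c t) (δ (f t) j)) ⟩
  ⊕ (λ t → ⊕ (λ j → c t ∧ (δ (f t) j ∧ M i j)))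
    ≡⟨ ⊕-cong (λ t → sym (∧-distribˡ-⊕ (c t) λ j → δ (f t) j ∧ M i j)) ⟩
  ⊕ (λ t → c t ∧ ⊕ (λ j → δ (f t) j ∧ M i j))
    ≡⟨ ⊕-cong (λ t → cong (c t ∧_) (⊕-δ (f t) (M i))) ⟩
  ⊕ (λ t → c t ∧ M i (f t)) ∎
  where
  open ≡-Reasoning
  x : Fin n → Bool
  x j = ⊕ (λ t → c t ∧ δ (f t) j)

record RankNullity {m n} (M : BMatrix m n) : Set where
  field
    rank        : ℕ
    basis       : Fin rank → Fin n
    independent : IndependentCols M basis
    spanning    : ∀ j → InSpan (λ t → column M (basis t)) (column M j)
    rank≤n      : rank ≤ n
    ∣ker∣       : ∣ ker M ∣ᵥ ≡ 2 ^ (n ∸ rank)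

dropFirstColumn : ∀ {m n} → BMatrix m (suc n) → BMatrix m n
dropFirstColumn M i j = M i (suc j)

∣ker∣-firstHalf : ∀ {m n} (M : BMatrix m (suc n)) →
                  ∣ (λ x → ker M (false ∷ x)) ∣ᵥ ≡ ∣ ker (dropFirstColumn M) ∣ᵥ
∣ker∣-firstHalf M = ∣∣ᵥ-cong λ x → allFalse-cong λ i →
  cong (_xor (dropFirstColumn M · x) i) (∧-zeroʳ (M i zero))

module _ {m n} (M : BMatrix m (suc n)) (IH : RankNullity (dropFirstColumn M)) where
  open RankNullity IH
  private
    M′ : BMatrix m n
    M′ = dropFirstColumn M

  rankNullity-dependent : (x₀ : Vec Bool n) → (true ∷ x₀) ∈ᵥ ker M → RankNullity M
  rankNullity-dependent x₀ x₀∈ = record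
    { rank = rank ; basis = λ t → suc (basis t) ; independent = independent
    ; spanning = spanning′ ; rank≤n = m≤n⇒m≤1+n rank≤n ; ∣ker∣ = ∣ker∣′ }
    where
    column₀≡ : ∀ i → M i zero ≡ (M′ · x₀) i
    column₀≡ i = trans (sym (∧-identityʳ (M i zero))) (xor≡false⇒≡ (allFalse-elim _ x₀∈ i))
    spanning′ : ∀ j → InSpan (λ t → column M (suc (basis t))) (column M j)
    spanning′ zero    =
      let (d , M′x₀≗) = InSpan-lincomb _ (column M′) spanning (lookup x₀)
      in d , λ i → trans (column₀≡ i) (trans (·-as-lincomb M′ x₀ i) (M′x₀≗ i))
    spanning′ (suc j) = spanning j
    secondHalf : ∣ (λ x → ker M (true ∷ x)) ∣ᵥ ≡ ∣ ker M′ ∣ᵥ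
    secondHalf = trans
      (∣∣ᵥ-cong λ x → allFalse-cong λ i →
         trans (cong (_xor (M′ · x) i) (trans (∧-identityʳ (M i zero)) (column₀≡ i)))
               (sym (dot-xorʳ (M′ i) x₀ x)))
      (∣∣ᵥ-translate x₀ (ker M′))
    ∣ker∣′ : ∣ ker M ∣ᵥ ≡ 2 ^ (suc n ∸ rank)
    ∣ker∣′ = begin
      ∣ ker M ∣ᵥ
        ≡⟨ ∣∣ᵥ-suc (ker M) ⟩
      ∣ (λ x → ker M (false ∷ x)) ∣ᵥ + ∣ (λ x → ker M (true ∷ x)) ∣ᵥ
        ≡⟨ cong₂ _+_ (trans (∣ker∣-firstHalf M) ∣ker∣) (trans secondHalf ∣ker∣) ⟩
      2 ^ (n ∸ rank) + 2 ^ (n ∸ rank)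
        ≡⟨ cong (2 ^ (n ∸ rank) +_) (sym (+-identityʳ _)) ⟩
      2 ^ suc (n ∸ rank)
        ≡⟨ cong (2 ^_) (sym (+-∸-assoc 1 rank≤n)) ⟩
      2 ^ (suc n ∸ rank) ∎
      where open ≡-Reasoning

  rankNullity-independent : (∀ x → ker M (true ∷ x) ≡ false) → RankNullity M
  rankNullity-independent ker₁≡∅ = record
    { rank = suc rank ; basis = basis′ ; independent = independent′
    ; spanning = spanning′ ; rank≤n = s≤s rank≤n ; ∣ker∣ = ∣ker∣′ }
    where
    basis′ : Fin (suc rank) → Fin (suc n)
    basis′ zero    = zero
    basis′ (suc t) = suc (basis t)
    independent′ : IndependentCols M basis′
    independent′ c c≡0 t with c zero in c₀≡
    independent′ c c≡0 zero    | false = c₀≡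
    independent′ c c≡0 (suc t) | false = independent (λ t → c (suc t)) c≡0 t
    ... | true = contradiction (trans (sym x∈) (ker₁≡∅ x)) λ ()
      where
      combination : Σ (Vec Bool n) λ x → M′ · x ≗ lincomb (λ t → c (suc t)) (λ t → column M′ (basis t))
      combination = lincomb-columns M′ basis (λ t → c (suc t))
      x : Vec Bool n
      x = proj₁ combination
      x∈ : (true ∷ x) ∈ᵥ ker M
      x∈ = allFalse-intro λ i → trans
        (cong (_xor (M′ · x) i) (∧-identityʳ (M i zero)))
        (≡⇒xor≡false {M i zero} (trans (xor≡false⇒≡ (c≡0 i)) (sym (proj₂ combination i))))
    spanning′ : ∀ j → InSpan (λ t → column M (basis′ t)) (column M j)
    spanning′ zero    = δ zero , λ i → sym (trans (cong (M i zero xor_) (⊕-zero {rank} λ _ → refl))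
                                                  (xor-identityʳ (M i zero)))
    spanning′ (suc j) = let (d , Mj≗) = spanning j in (λ { zero → false ; (suc t) → d t }) , Mj≗
    ∣ker∣′ : ∣ ker M ∣ᵥ ≡ 2 ^ (n ∸ rank)
    ∣ker∣′ = trans (∣∣ᵥ-suc (ker M))
      (trans (cong₂ _+_ (trans (∣ker∣-firstHalf M) ∣ker∣) (∣∣ᵥ-empty ker₁≡∅)) (+-identityʳ _))

rankNullity : ∀ {m n} (M : BMatrix m n) → RankNullity M
rankNullity {n = zero} M = record
  { rank = 0 ; basis = λ () ; independent = λ _ _ () ; spanning = λ ()
  ; rank≤n = z≤n
  ; ∣ker∣ = trans (∣∣ᵥ-zero (ker M)) (cong (if_then 1 else 0) (allFalse-intro {f = M · []} λ _ → refl)) }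
-- Either the first column is a combination of the others, witnessed by (true ∷ x₀) ∈ ker M,
-- or it is independent of them.
rankNullity {n = suc n} M with find (λ x → ker M (true ∷ x))
... | inj₁ (x₀ , x₀∈) = rankNullity-dependent M (rankNullity (dropFirstColumn M)) x₀ x₀∈
... | inj₂ ker₁≡∅     = rankNullity-independent M (rankNullity (dropFirstColumn M)) ker₁≡∅

rankOf : ∀ {m n} → BMatrix m n → ℕ
rankOf M = RankNullity.rank (rankNullity M)

rank-nullity : ∀ {m n} (M : BMatrix m n) → ∣ ker M ∣ᵥ ≡ 2 ^ (n ∸ rankOf M)
rank-nullity M = RankNullity.∣ker∣ (rankNullity M)

isRank : ∀ {m n} (M : BMatrix m n) → IsRank M (rankOf M)
isRank M = (basis , independent) , λ k f f-independent →
  steinitz (λ t → column M (f t)) (λ t → column M (basis t)) f-independent (λ t → spanning (f t))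
  where open RankNullity (rankNullity M)

IsRank-unique : ∀ {m n} {M : BMatrix m n} {r s} → IsRank M r → IsRank M s → r ≡ s
IsRank-unique ((f , f-ind) , r-max) ((g , g-ind) , s-max) =
  ≤-antisym (s-max _ f f-ind) (r-max _ g g-ind)

IndependentCols-≗ : ∀ {m n k} {M N : BMatrix m n} → (∀ i j → M i j ≡ N i j) →
                    (f : Fin k → Fin n) → IndependentCols M f → IndependentCols N f
IndependentCols-≗ M≗N f f-ind c c≡0 =
  f-ind c λ i → trans (⊕-cong λ t → cong (c t ∧_) (M≗N i (f t))) (c≡0 i)

IsRank-≗ : ∀ {m n} {M N : BMatrix m n} → (∀ i j → M i j ≡ N i j) → ∀ {r} → IsRank M r → IsRank N r
IsRank-≗ M≗N ((f , f-ind) , r-max) =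
  (f , IndependentCols-≗ M≗N f f-ind) ,
  λ k g g-ind → r-max k g (IndependentCols-≗ (λ i j → sym (M≗N i j)) g g-ind)

-- Completions of minimum rank

Minimizable : Set → Set
Minimizable X = (f : X → ℕ) → Σ X λ x → ∀ y → f x ≤ f y

minimizable-Bool : Minimizable Bool
minimizable-Bool f with f false ≤? f true
... | yes f₀≤f₁ = false , λ { false → ≤-refl ; true → f₀≤f₁ }
... | no  f₀≰f₁ = true  , λ { false → <⇒≤ (≰⇒> f₀≰f₁) ; true → ≤-refl }

minimizable-Vec : ∀ {X : Set} → Minimizable X → ∀ k → Minimizable (Vec X k)
minimizable-Vec min-X zero    f = [] , λ { [] → ≤-refl }
minimizable-Vec {X} min-X (suc k) f =
  let (x₀ , x₀-min) = min-X (λ x → f (x ∷ best x))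
  in x₀ ∷ best x₀ , λ { (y ∷ ys) → ≤-trans (x₀-min y) (proj₂ (min-tail y) ys) }
  where
  min-tail : ∀ x → Σ (Vec X k) λ xs → ∀ ys → f (x ∷ xs) ≤ f (x ∷ ys)
  min-tail x = minimizable-Vec min-X k (λ xs → f (x ∷ xs))
  best : X → Vec X k
  best x = proj₁ (min-tail x)

fill : Entry → Bool → Bool
fill 0ₑ _ = false
fill 1ₑ _ = true
fill ∗  b = b

Agrees-fill : ∀ e b → Agrees e (fill e b)
Agrees-fill 0ₑ b = refl
Agrees-fill 1ₑ b = refl
Agrees-fill ∗  b = tt

fill-Agrees : ∀ {e b} → Agrees e b → fill e b ≡ b
fill-Agrees {0ₑ} b≡false = sym b≡false
fill-Agrees {1ₑ} b≡true  = sym b≡true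
fill-Agrees {∗}  _       = refl

-- Completions are indexed by a choice vector C, of which only the ∗-entries are read:
-- minimizing over Vec (Vec Bool n) m, unlike over functions, needs no function
-- extensionality.
completionOf : ∀ {m n} → PMatrix m n → Vec (Vec Bool n) m → BMatrix m n
completionOf A C i j = fill (A i j) (lookup (lookup C i) j)

minRankCompletion : ∀ {m n} (A : PMatrix m n) →
  Σ (BMatrix m n) λ M → IsCompletion A M × (∀ N → IsCompletion A N → rankOf M ≤ rankOf N)
minRankCompletion {m} {n} A = completionOf A C , completion , minimal
  where
  C-min : Σ (Vec (Vec Bool n) m) λ C →
          ∀ C′ → rankOf (completionOf A C) ≤ rankOf (completionOf A C′)
  C-min = minimizable-Vec (minimizable-Vec minimizable-Bool n) m (λ C → rankOf (completionOf A C))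
  C : Vec (Vec Bool n) m
  C = proj₁ C-min
  completion : IsCompletion A (completionOf A C)
  completion i j = Agrees-fill (A i j) _
  minimal : ∀ N → IsCompletion A N → rankOf (completionOf A C) ≤ rankOf N
  minimal N N-completion = ≤-trans (proj₂ C-min C-N) (≤-reflexive
    (IsRank-unique {M = N} (IsRank-≗ {M = completionOf A C-N} filled≗N (isRank _)) (isRank N)))
    where
    C-N : Vec (Vec Bool n) m
    C-N = tabulate (λ i → tabulate (N i))
    filled≗N : ∀ i j → completionOf A C-N i j ≡ N i j
    filled≗N i j rewrite lookup∘tabulate (λ i → tabulate (N i)) i | lookup∘tabulate (N i) j =
      fill-Agrees (N-completion i j)

-- Linear solutions lie in kernels of completions

_∩ᵥ_ : ∀ {n} → VSet n → VSet n → VSet n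
(L ∩ᵥ L′) x = L x ∧ L′ x

∈-∩ᵥ⁺ : ∀ {n} (L L′ : VSet n) {x} → x ∈ᵥ L → x ∈ᵥ L′ → x ∈ᵥ (L ∩ᵥ L′)
∈-∩ᵥ⁺ L L′ x∈L x∈L′ = cong₂ _∧_ x∈L x∈L′

∈-∩ᵥ⁻ : ∀ {n} (L L′ : VSet n) {x} → x ∈ᵥ (L ∩ᵥ L′) → x ∈ᵥ L × x ∈ᵥ L′
∈-∩ᵥ⁻ L L′ {x} x∈ = ∧-conicalˡ (L x) (L′ x) x∈ , ∧-conicalʳ (L x) (L′ x) x∈

IsSubspace-∩ᵥ : ∀ {n} {L L′ : VSet n} → IsSubspace L → IsSubspace L′ → IsSubspace (L ∩ᵥ L′)
IsSubspace-∩ᵥ {L = L} {L′} (0∈L , L-closed) (0∈L′ , L′-closed) =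
  ∈-∩ᵥ⁺ L L′ 0∈L 0∈L′ ,
  λ x y x∈ y∈ → let (x∈L , x∈L′) = ∈-∩ᵥ⁻ L L′ x∈ ; (y∈L , y∈L′) = ∈-∩ᵥ⁻ L L′ y∈
                in ∈-∩ᵥ⁺ L L′ (L-closed x y x∈L y∈L) (L′-closed x y x∈L′ y∈L′)

zeroAt : ∀ {n} → Fin n → VSet n
zeroAt j x = not (lookup x j)

∈-zeroAt⁻ : ∀ {n} {j : Fin n} {x} → x ∈ᵥ zeroAt j → lookup x j ≡ false
∈-zeroAt⁻ {j = j} {x} x∈ = trans (sym (not-involutive (lookup x j))) (cong not x∈)

IsSubspace-zeroAt : ∀ {n} (j : Fin n) → IsSubspace (zeroAt j)
IsSubspace-zeroAt {n} j =
  cong not (lookup-replicate j false) ,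
  λ x y x∈ y∈ → cong not (trans (lookup-zipWith _xor_ j x y)
                                 (cong₂ _xor_ (∈-zeroAt⁻ {j = j} {x} x∈) (∈-zeroAt⁻ {j = j} {y} y∈)))

dot-xorUnit : ∀ {n} (c : Fin n → Bool) β (j : Fin n) (x : Vec Bool n) →
              dot (λ k → c k xor (β ∧ δ j k)) x ≡ dot c x xor (β ∧ lookup x j)
dot-xorUnit c β j x = trans (dot-xorˡ c (λ k → β ∧ δ j k) x) (cong (dot c x xor_) (begin
  ⊕ (λ k → (β ∧ δ j k) ∧ lookup x k)  ≡⟨ ⊕-cong (λ k → ∧-assoc β (δ j k) (lookup x k)) ⟩
  ⊕ (λ k → β ∧ (δ j k ∧ lookup x k))  ≡⟨ sym (∧-distribˡ-⊕ β λ k → δ j k ∧ lookup x k) ⟩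
  β ∧ ⊕ (λ k → δ j k ∧ lookup x k)    ≡⟨ cong (β ∧_) (⊕-δ j (lookup x)) ⟩
  β ∧ lookup x j                      ∎))
  where open ≡-Reasoning

-- If some x₀ ∈ L has x₀ j = 1, then every x ∈ L with x j = 1 differs from x₀ by a vector
-- of L ∩ zeroAt j, so a - c is constant on such x; the coordinate functional x ↦ x j
-- absorbs that constant.
extendAgreement : ∀ {n} {L : VSet n} → IsSubspace L → (j : Fin n) (a c : Fin n → Bool) →
  (∀ x → x ∈ᵥ (L ∩ᵥ zeroAt j) → dot a x ≡ dot c x) →
  Σ Bool λ β → ∀ x → x ∈ᵥ L → dot a x ≡ dot (λ k → c k xor (β ∧ δ j k)) x
extendAgreement {n} {L} (_ , L-closed) j a c a≡c with find (L ∩ᵥ λ x → lookup x j)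
... | inj₂ L∩oneAt≡∅ = false , λ x x∈L → begin
  dot a x                          ≡⟨ a≡c x (∈-∩ᵥ⁺ L (zeroAt j) x∈L (cong not (xⱼ≡false x x∈L))) ⟩
  dot c x                          ≡⟨ sym (xor-identityʳ (dot c x)) ⟩
  dot c x xor false                ≡⟨ sym (dot-xorUnit c false j x) ⟩
  dot (λ k → c k xor false) x      ∎
  where
  open ≡-Reasoning
  xⱼ≡false : ∀ x → x ∈ᵥ L → lookup x j ≡ false
  xⱼ≡false x x∈L = trans (sym (cong (_∧ lookup x j) x∈L)) (L∩oneAt≡∅ x)
... | inj₁ (x₀ , x₀∈) = β , λ x x∈L → trans (agrees x x∈L) (sym (dot-xorUnit c β j x))
  where
  x₀∈L : x₀ ∈ᵥ L
  x₀∈L = proj₁ (∈-∩ᵥ⁻ L (λ x → lookup x j) x₀∈)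
  x₀ⱼ≡true : lookup x₀ j ≡ true
  x₀ⱼ≡true = proj₂ (∈-∩ᵥ⁻ L (λ x → lookup x j) x₀∈)
  β : Bool
  β = dot a x₀ xor dot c x₀
  agrees : ∀ x → x ∈ᵥ L → dot a x ≡ dot c x xor (β ∧ lookup x j)
  agrees x x∈L with lookup x j in xⱼ≡
  ... | false = trans (a≡c x (∈-∩ᵥ⁺ L (zeroAt j) x∈L (cong not xⱼ≡)))
                      (sym (trans (cong (dot c x xor_) (∧-zeroʳ β)) (xor-identityʳ (dot c x))))
  ... | true  = trans (xor-cancel {c = dot c x} {dot c x₀} a-diff≡c-diff)
                      (cong (dot c x xor_) (sym (∧-identityʳ β)))
    where
    x+x₀∈ : zipWith _xor_ x x₀ ∈ᵥ (L ∩ᵥ zeroAt j)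
    x+x₀∈ = ∈-∩ᵥ⁺ L (zeroAt j) (L-closed x x₀ x∈L x₀∈L)
      (cong not (trans (lookup-zipWith _xor_ j x x₀) (cong₂ _xor_ xⱼ≡ x₀ⱼ≡true)))
    a-diff≡c-diff : dot a x xor dot a x₀ ≡ dot c x xor dot c x₀
    a-diff≡c-diff = trans (sym (dot-xorʳ a x x₀)) (trans (a≡c _ x+x₀∈) (dot-xorʳ c x x₀))

agreesWithSupported : ∀ {n} (js : List (Fin n)) {L : VSet n} → IsSubspace L → (a : Fin n → Bool) →
  (∀ x → x ∈ᵥ L → (∀ j → j ∈ js → lookup x j ≡ false) → dot a x ≡ false) →
  Σ (Fin n → Bool) λ c → (∀ j → c j ≡ true → j ∈ js) × (∀ x → x ∈ᵥ L → dot a x ≡ dot c x)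
agreesWithSupported {n} List.[] L-sub a a-vanishes =
  (λ _ → false) , (λ _ ()) , λ x x∈L → trans (a-vanishes x x∈L λ _ ()) (sym (⊕-zero {n} λ _ → refl))
agreesWithSupported {n} (j List.∷ js) {L} L-sub a a-vanishes = c′ , c′-support , a≡c′
  where
  a-vanishes₀ : ∀ x → x ∈ᵥ (L ∩ᵥ zeroAt j) → (∀ k → k ∈ js → lookup x k ≡ false) → dot a x ≡ false
  a-vanishes₀ x x∈ x-zero = a-vanishes x (proj₁ (∈-∩ᵥ⁻ L (zeroAt j) x∈)) λ
    { k (here refl) → ∈-zeroAt⁻ {j = j} {x} (proj₂ (∈-∩ᵥ⁻ L (zeroAt j) x∈))
    ; k (there k∈)  → x-zero k k∈ }
  IH : Σ (Fin n → Bool) λ c →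
       (∀ k → c k ≡ true → k ∈ js) × (∀ x → x ∈ᵥ (L ∩ᵥ zeroAt j) → dot a x ≡ dot c x)
  IH = agreesWithSupported js (IsSubspace-∩ᵥ L-sub (IsSubspace-zeroAt j)) a a-vanishes₀
  c : Fin n → Bool
  c = proj₁ IH
  extension : Σ Bool λ β → ∀ x → x ∈ᵥ L → dot a x ≡ dot (λ k → c k xor (β ∧ δ j k)) x
  extension = extendAgreement L-sub j a c (proj₂ (proj₂ IH))
  β : Bool
  β = proj₁ extension
  c′ : Fin n → Bool
  c′ k = c k xor (β ∧ δ j k)
  a≡c′ : ∀ x → x ∈ᵥ L → dot a x ≡ dot c′ x
  a≡c′ = proj₂ extension
  c′-support : ∀ k → c′ k ≡ true → k ∈ j List.∷ js
  c′-support k c′k≡true with c k in cₖ≡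
  ... | true  = there (proj₁ (proj₂ IH) k cₖ≡)
  ... | false = here (sym (δ≡true⇒≡ (∧-conicalʳ β (δ j k) c′k≡true)))

ker-isLinearSolution : ∀ {m n} (A : PMatrix m n) {M : BMatrix m n} →
                       IsCompletion A M → IsLinearSolution A (ker M)
ker-isLinearSolution {m} A {M} M-completion =
  (M , (λ _ → replicate m false) , M-completion , (λ _ _ _ _ → refl) ,
   λ x x∈ i → trans (allFalse-elim _ x∈ i) (sym (lookup-replicate i false))) ,
  ker-isSubspace M

isStar? : Decidable IsStar
isStar? 0ₑ = no λ ()
isStar? 1ₑ = no λ ()
isStar? ∗  = yes tt

Agrees-xor : ∀ {e b c} → Agrees e b → (c ≡ true → IsStar e) → Agrees e (b xor c)
Agrees-xor {∗}              _   _      = tt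
Agrees-xor {0ₑ} {b} {false} agr _      = trans (xor-identityʳ b) agr
Agrees-xor {1ₑ} {b} {false} agr _      = trans (xor-identityʳ b) agr
Agrees-xor {0ₑ} {c = true}  _   c-star = ⊥-elim (c-star refl)
Agrees-xor {1ₑ} {c = true}  _   c-star = ⊥-elim (c-star refl)

linearSolution⊆ker : ∀ {m n} (A : PMatrix m n) (L : VSet n) → IsLinearSolution A L →
  Σ (BMatrix m n) λ M′ → IsCompletion A M′ × (∀ x → x ∈ᵥ L → x ∈ᵥ ker M′)
linearSolution⊆ker {m} {n} A L ((M , G , M-completion , G-consistent , Mx≡Gx) , L-sub) =
  M′ , M′-completion , L⊆kerM′
  where
  stars : Fin m → List (Fin n)
  stars i = List.filter (λ j → isStar? (A i j)) (allFin n)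
  rowVanishes : ∀ i x → x ∈ᵥ L → (∀ j → j ∈ stars i → lookup x j ≡ false) → dot (M i) x ≡ false
  rowVanishes i x x∈L x-zero = begin
    dot (M i) x                       ≡⟨ Mx≡Gx x x∈L i ⟩
    lookup (G x) i                    ≡⟨ G-consistent i x (replicate n false) x≡0-on-stars ⟩
    lookup (G (replicate n false)) i  ≡⟨ sym (Mx≡Gx _ (proj₁ L-sub) i) ⟩
    dot (M i) (replicate n false)     ≡⟨ dot-zeroʳ (M i) ⟩
    false                             ∎
    where
    open ≡-Reasoning
    x≡0-on-stars : ∀ j → IsStar (A i j) → lookup x j ≡ lookup (replicate n false) j
    x≡0-on-stars j star = trans (x-zero j (∈-filter⁺ (λ j → isStar? (A i j)) (∈-allFin j) star))
                                (sym (lookup-replicate j false))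
  correction : ∀ i → Σ (Fin n → Bool) λ c →
               (∀ j → c j ≡ true → j ∈ stars i) × (∀ x → x ∈ᵥ L → dot (M i) x ≡ dot c x)
  correction i = agreesWithSupported (stars i) L-sub (M i) (rowVanishes i)
  M′ : BMatrix m n
  M′ i j = M i j xor proj₁ (correction i) j
  M′-completion : IsCompletion A M′
  M′-completion i j = Agrees-xor (M-completion i j)
    λ cᵢⱼ≡true → proj₂ (∈-filter⁻ (λ j → isStar? (A i j)) {xs = allFin n}
                                  (proj₁ (proj₂ (correction i)) j cᵢⱼ≡true))
  L⊆kerM′ : ∀ x → x ∈ᵥ L → x ∈ᵥ ker M′
  L⊆kerM′ x x∈L = allFalse-intro λ i → trans (dot-xorˡ (M i) (proj₁ (correction i)) x)
    (≡⇒xor≡false (proj₂ (proj₂ (correction i)) x x∈L))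

corollary4 : (m n : ℕ) (A : PMatrix m n) →
             Σ ℕ (λ r → IsMinRank A r × IsLin A (2 ^ (n ∸ r)))
corollary4 m n A with minRankCompletion A
... | M , M-completion , M-minimal = rankOf M , minRank , lin
  where
  minRank : IsMinRank A (rankOf M)
  minRank = (M , M-completion , isRank M) , λ N s N-completion N-rank →
    subst (rankOf M ≤_) (IsRank-unique {M = N} (isRank N) N-rank) (M-minimal N N-completion)
  lin : IsLin A (2 ^ (n ∸ rankOf M))
  lin = (ker M , ker-isLinearSolution A M-completion , rank-nullity M) , λ L L-solution →
    let (N , N-completion , L⊆kerN) = linearSolution⊆ker A L L-solution
    in begin
      ∣ L ∣ᵥ               ≤⟨ ∣∣ᵥ-mono L⊆kerN ⟩
      ∣ ker N ∣ᵥ           ≡⟨ rank-nullity N ⟩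
      2 ^ (n ∸ rankOf N)   ≤⟨ ^-monoʳ-≤ 2 (∸-monoʳ-≤ n (M-minimal N N-completion)) ⟩
      2 ^ (n ∸ rankOf M)   ∎
    where open ≤-Reasoning
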